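{- Let $T$ be a tree and let $G$ be the graph obtained from $T$ and a new vertex $u^*$ (not in $T$) by adding $t$ edges between $u^*$ and vertices of $T$, where $1\le t\le v(T)$. Then $\phi(G)=\lfloor t/2\rfloor$.
   Context: Graphs are simple, so $u^*$ is joined to $t$ distinct vertices of $T$. $v(T)$ is the number of vertices of $T$, and $\phi(G)$ denotes the maximum number of pairwise edge-disjoint cycles in $G$. -}

module Defs where

open import Level using (0ℓ)
open import Data.Nat using (ℕ; zero; suc; _+_; _≤_; _/_)
open import Data.Fin using (Fin; zero; suc; inject₁; fromℕ)
open import Data.Fin.Subset using (Subset; _∈_; ∣_∣)
open import Data.Product using (Σ; _×_; _,_)
open import Data.Sum using (_⊎_)
open import Data.Empty using (⊥)
open import Relation.Nullary using (¬_)
open import Relation.Binary.PropositionalEquality using (_≡_)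
open import Relation.Binary.Construct.Closure.ReflexiveTransitive using (Star)
open import Function.Definitions using (Injective)

record Graph (n : ℕ) : Set₁ where
  field
    Adj    : Fin n → Fin n → Set
    sym    : ∀ {u v} → Adj u v → Adj v u
    irrefl : ∀ {u} → ¬ Adj u u
open Graph public

record Cycle {n : ℕ} (G : Graph n) : Set where
  field
    k      : ℕ
    verts  : Fin (3 + k) → Fin n
    inj    : Injective _≡_ _≡_ verts
    step   : ∀ (i : Fin (2 + k)) → Adj G (verts (inject₁ i)) (verts (suc i))
    close  : Adj G (verts (fromℕ (2 + k))) (verts zero)
open Cycle public

CycleEdge : ∀ {n} {G : Graph n} → Cycle G → Fin n → Fin n → Set
CycleEdge C u v =
  Σ (Fin (2 + k C)) (λ i →
      (verts C (inject₁ i) ≡ u × verts C (suc i) ≡ v)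
    ⊎ (verts C (inject₁ i) ≡ v × verts C (suc i) ≡ u))
  ⊎ ((verts C (fromℕ (2 + k C)) ≡ u × verts C zero ≡ v)
    ⊎ (verts C (fromℕ (2 + k C)) ≡ v × verts C zero ≡ u))

EdgeDisjoint : ∀ {n} {G : Graph n} → Cycle G → Cycle G → Set
EdgeDisjoint C D = ∀ u v → CycleEdge C u v → ¬ CycleEdge D u v

HasEdgeDisjointCycles : ∀ {n} → Graph n → ℕ → Set
HasEdgeDisjointCycles G m =
  Σ (Fin m → Cycle G) (λ Cs → ∀ i j → ¬ i ≡ j → EdgeDisjoint (Cs i) (Cs j))

φ-is : ∀ {n} → Graph n → ℕ → Set
φ-is G m = HasEdgeDisjointCycles G m × (∀ j → HasEdgeDisjointCycles G j → j ≤ m)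

Connected : ∀ {n} → Graph n → Set
Connected G = ∀ u v → Star (Adj G) u v

IsTree : ∀ {n} → Graph n → Set
IsTree G = Connected G × ¬ Cycle G

-- G = T + new vertex u* (= zero) joined to the vertices in S (vertex v of T is suc v).
addApex : ∀ {n} → Graph n → Subset n → Graph (suc n)
addApex {n} T S = record { Adj = A ; sym = λ {u} {v} → s {u} {v} ; irrefl = λ {u} → ir {u} }
  where
  A : Fin (suc n) → Fin (suc n) → Set
  A zero zero = ⊥
  A zero (suc v) = v ∈ S
  A (suc u) zero = u ∈ S
  A (suc u) (suc v) = Adj T u v
  s : ∀ {u v} → A u v → A v u
  s {zero} {zero} ()
  s {zero} {suc v} p = p
  s {suc u} {zero} p = p
  s {suc u} {suc v} p = sym T p
  ir : ∀ {u} → ¬ A u u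
  ir {zero} ()
  ir {suc u} p = irrefl T p

module Submission where

-- Since T is acyclic, every cycle of G passes through u* and uses two of its t edges, and
-- edge-disjoint cycles use disjoint pairs of them; hence φ(G) ≤ ⌊t/2⌋. Conversely, pair up
-- 2⌊t/2⌋ neighbours of u* and join each pair by a walk in T. While two walks share an edge, cut
-- both there and reconnect the four halves the other way: the pairs change, the total length
-- drops by two. Once no edge is shared, shortening each walk to a path and closing it through u*
-- gives ⌊t/2⌋ edge-disjoint cycles.

open import Defs renaming (sym to Adj-sym)
open import Data.Nat using (ℕ; zero; suc; _+_; _*_; _≤_; _<_; _/_)
open import Data.Nat.Properties using (+-suc; +-identityʳ; +-assoc; +-cancelʳ-<; +-monoʳ-<; n<1+n; m<n⇒m<1+n; module ≤-Reasoning; +-0-monoid)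
open import Data.Nat.DivMod using (m*n/n≡m; /-monoˡ-≤; m/n*n≤m)
open import Data.Nat.Induction using (<-wellFounded)
open import Data.Nat.Tactic.RingSolver using (solve-∀)
open import Data.Fin using (Fin; zero; suc; inject₁; fromℕ; inject≤; splitAt; join; punchOut)
open import Data.Fin.Properties using (suc-injective; injective⇒≤; join-splitAt; splitAt-join; inject≤-injective; punchOut-injective; any?) renaming (_≟_ to _≟ᶠ_)
open import Data.Fin.Subset using (Subset; _∈_; ∣_∣; inside; outside)
open import Data.Vec.Base using (_∷_; here; there)
open import Data.Vec.Functional using (Vector)
open import Algebra.Properties.Monoid.Sum +-0-monoid using (sum; sum-cong-≗)
open import Data.Product using (Σ; ∃; ∃₂; _×_; _,_; proj₁; proj₂)
open import Data.Sum using (_⊎_; inj₁; inj₂; [_,_]′)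
open import Data.Unit using (⊤; tt)
open import Data.Empty using (⊥; ⊥-elim)
open import Function using (_∘_; id; flip; case_of_)
open import Function.Definitions using (Injective)
open import Induction.WellFounded using (Acc; acc)
open import Relation.Nullary using (¬_; Dec; yes; no)
open import Relation.Nullary.Decidable using (_×-dec_; _⊎-dec_; ¬?)
open import Relation.Binary.PropositionalEquality using (_≡_; _≢_; refl; sym; trans; cong; cong₂; subst; subst₂; module ≡-Reasoning)
open import Relation.Binary.Construct.Closure.ReflexiveTransitive using (Star; ε; _◅_; _◅◅_; revApp; reverse)

private variable
  m n : ℕ

rank : (S : Subset n) {x : Fin n} → x ∈ S → Fin ∣ S ∣
rank (inside ∷ S) here = zero
rank (inside ∷ S) (there p) = suc (rank S p)
rank (outside ∷ S) (there p) = rank S p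

rank-injective : (S : Subset n) {x y : Fin n} (p : x ∈ S) (q : y ∈ S) → rank S p ≡ rank S q → x ≡ y
rank-injective (inside ∷ S) here here _ = refl
rank-injective (inside ∷ S) (there p) (there q) e = cong suc (rank-injective S p q (suc-injective e))
rank-injective (outside ∷ S) (there p) (there q) e = cong suc (rank-injective S p q e)

injective-into⇒≤∣∣ : (S : Subset n) (f : Fin m → Fin n) → Injective _≡_ _≡_ f → (∀ i → f i ∈ S) → m ≤ ∣ S ∣
injective-into⇒≤∣∣ S f f-inj f∈S =
  injective⇒≤ λ {i} {j} e → f-inj (rank-injective S (f∈S i) (f∈S j) e)

enumerate : (S : Subset n) → Fin ∣ S ∣ → Fin n
enumerate (inside ∷ S) zero = zero
enumerate (inside ∷ S) (suc i) = suc (enumerate S i)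
enumerate (outside ∷ S) i = suc (enumerate S i)

enumerate-∈ : (S : Subset n) (i : Fin ∣ S ∣) → enumerate S i ∈ S
enumerate-∈ (inside ∷ S) zero = here
enumerate-∈ (inside ∷ S) (suc i) = there (enumerate-∈ S i)
enumerate-∈ (outside ∷ S) i = there (enumerate-∈ S i)

enumerate-injective : (S : Subset n) → Injective _≡_ _≡_ (enumerate S)
enumerate-injective (inside ∷ S) {zero} {zero} _ = refl
enumerate-injective (inside ∷ S) {suc i} {suc j} e = cong suc (enumerate-injective S (suc-injective e))
enumerate-injective (outside ∷ S) e = enumerate-injective S (suc-injective e)

m+m≡m*2 : ∀ m → m + m ≡ m * 2
m+m≡m*2 = solve-∀

m+m≤n⇒m≤n/2 : ∀ m n → m + m ≤ n → m ≤ n / 2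
m+m≤n⇒m≤n/2 m n m+m≤n =
  subst (_≤ n / 2) (trans (cong (_/ 2) (m+m≡m*2 m)) (m*n/n≡m m 2)) (/-monoˡ-≤ 2 m+m≤n)

n/2+n/2≤n : ∀ n → n / 2 + n / 2 ≤ n
n/2+n/2≤n n = subst (_≤ n) (sym (m+m≡m*2 (n / 2))) (m/n*n≤m n 2)

splitAt-injective : ∀ m {n} → Injective _≡_ _≡_ (splitAt m {n})
splitAt-injective m {n} {x} {y} eq = begin
  x                     ≡⟨ join-splitAt m n x ⟨
  join m n (splitAt m x) ≡⟨ cong (join m n) eq ⟩
  join m n (splitAt m y) ≡⟨ join-splitAt m n y ⟩
  y                     ∎
  where open ≡-Reasoning

join-injective : ∀ m {n} → Injective _≡_ _≡_ (join m n)
join-injective m {n} {p} {p′} eq = begin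
  p                     ≡⟨ splitAt-join m n p ⟨
  splitAt m (join m n p) ≡⟨ cong (splitAt m) eq ⟩
  splitAt m (join m n p′) ≡⟨ splitAt-join m n p′ ⟩
  p′                    ∎
  where open ≡-Reasoning

pairs-injection⇒≤∣∣ : (S : Subset n) (f : Fin m ⊎ Fin m → Fin n) → Injective _≡_ _≡_ f → (∀ p → f p ∈ S) →
                      m + m ≤ ∣ S ∣
pairs-injection⇒≤∣∣ {m = m} S f f-inj f∈S =
  injective-into⇒≤∣∣ S (f ∘ splitAt m) (splitAt-injective m ∘ f-inj) (f∈S ∘ splitAt m)

pairs-injection : (S : Subset n) → let m = ∣ S ∣ / 2 in
                  Σ (Fin m ⊎ Fin m → Fin n) λ f → Injective _≡_ _≡_ f × (∀ p → f p ∈ S)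
pairs-injection S =
  enumerate S ∘ into ,
  (λ eq → join-injective half (inject≤-injective ½+½≤∣S∣ ½+½≤∣S∣ _ _ (enumerate-injective S eq))) ,
  enumerate-∈ S ∘ into
  where
  half : ℕ
  half = ∣ S ∣ / 2
  ½+½≤∣S∣ : half + half ≤ ∣ S ∣
  ½+½≤∣S∣ = n/2+n/2≤n ∣ S ∣
  into : Fin half ⊎ Fin half → Fin ∣ S ∣
  into p = inject≤ (join half half p) ½+½≤∣S∣

replace : {A : Set} → Vector A m → Fin m → A → Vector A m
replace xs i x q with q ≟ᶠ i
... | yes _ = x
... | no _ = xs q

replace-≢ : {A : Set} (xs : Vector A m) {i : Fin m} (x : A) {q : Fin m} → q ≢ i → replace xs i x q ≡ xs q
replace-≢ xs {i} x {q} q≢i with q ≟ᶠ i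
... | yes q≡i = ⊥-elim (q≢i q≡i)
... | no _ = refl

replace-≡ : {A : Set} (xs : Vector A m) (i : Fin m) (x : A) → replace xs i x i ≡ x
replace-≡ xs i x with i ≟ᶠ i
... | yes _ = refl
... | no i≢i = ⊥-elim (i≢i refl)

sum-update : (f g : Vector ℕ m) (i : Fin m) → (∀ q → q ≢ i → f q ≡ g q) → sum f + g i ≡ sum g + f i
sum-update {suc m} f g zero f≈g = begin
  f zero + sum (f ∘ suc) + g zero ≡⟨ cong (λ s → f zero + s + g zero) (sum-cong-≗ (λ q → f≈g (suc q) λ ())) ⟩
  f zero + sum (g ∘ suc) + g zero ≡⟨ swap-outer (f zero) (sum (g ∘ suc)) (g zero) ⟩
  g zero + sum (g ∘ suc) + f zero ∎
  where
  open ≡-Reasoning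
  swap-outer : ∀ a b c → a + b + c ≡ c + b + a
  swap-outer = solve-∀
sum-update {suc m} f g (suc i) f≈g = begin
  f zero + sum (f ∘ suc) + g (suc i)   ≡⟨ +-assoc (f zero) _ _ ⟩
  f zero + (sum (f ∘ suc) + g (suc i)) ≡⟨ cong₂ _+_ (f≈g zero λ ()) (sum-update (f ∘ suc) (g ∘ suc) i tail≈) ⟩
  g zero + (sum (g ∘ suc) + f (suc i)) ≡⟨ sym (+-assoc (g zero) _ _) ⟩
  g zero + sum (g ∘ suc) + f (suc i)   ∎
  where
  open ≡-Reasoning
  tail≈ : ∀ q → q ≢ i → f (suc q) ≡ g (suc q)
  tail≈ q q≢i = f≈g (suc q) (q≢i ∘ suc-injective)

data LastView : ∀ {m} → Fin (suc m) → Set where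
  last   : LastView (fromℕ m)
  inject : (i : Fin m) → LastView (inject₁ i)

lastView : (i : Fin (suc m)) → LastView i
lastView {zero} zero = last
lastView {suc m} zero = inject zero
lastView {suc m} (suc i) with lastView i
... | last = last
... | inject j = inject (suc j)

inject₁²≢suc² : (i : Fin m) → inject₁ (inject₁ i) ≢ suc (suc i)
inject₁²≢suc² zero ()
inject₁²≢suc² (suc i) eq = inject₁²≢suc² i (suc-injective eq)

module _ {G : Graph n} where

  CycleEdge-adj : (C : Cycle G) {u v : Fin n} → CycleEdge C u v → Adj G u v
  CycleEdge-adj C (inj₁ (i , inj₁ (refl , refl))) = step C i
  CycleEdge-adj C (inj₁ (i , inj₂ (refl , refl))) = Adj-sym G (step C i)
  CycleEdge-adj C (inj₂ (inj₁ (refl , refl))) = close C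
  CycleEdge-adj C (inj₂ (inj₂ (refl , refl))) = Adj-sym G (close C)

  record Neighbours (C : Cycle G) (u : Fin n) : Set where
    field
      left right : Fin n
      left≢right : left ≢ right
      left-edge  : CycleEdge C u left
      right-edge : CycleEdge C u right

  -- The two positions next to p differ because a cycle has at least three vertices.
  cycle-neighbours : (C : Cycle G) (p : Fin (3 + k C)) → Neighbours C (verts C p)
  cycle-neighbours C zero = record
    { left≢right = (λ ()) ∘ inj C
    ; left-edge = inj₁ (zero , inj₁ (refl , refl))
    ; right-edge = inj₂ (inj₂ (refl , refl)) }
  cycle-neighbours C (suc p) with lastView p
  ... | last = record
    { left≢right = (λ ()) ∘ inj C
    ; left-edge = inj₁ (fromℕ (suc (k C)) , inj₂ (refl , refl))
    ; right-edge = inj₂ (inj₁ (refl , refl)) }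
  ... | inject i = record
    { left≢right = inject₁²≢suc² i ∘ inj C
    ; left-edge = inj₁ (inject₁ i , inj₂ (refl , refl))
    ; right-edge = inj₁ (suc i , inj₁ (refl , refl)) }

  cycles-through⇒neighbours : ∀ {j} (Cs : Fin j → Cycle G) → (∀ q q′ → q ≢ q′ → EdgeDisjoint (Cs q) (Cs q′)) →
                              (v : Fin n) → (∀ q → ∃ λ p → verts (Cs q) p ≡ v) →
                              Σ (Fin j ⊎ Fin j → Fin n) λ f → Injective _≡_ _≡_ f × (∀ p → Adj G v (f p))
  cycles-through⇒neighbours {j} Cs disjoint v through =
    end , end-injective , λ p → CycleEdge-adj (Cs (owner p)) (end-edge p)
    where
    neighbours : ∀ q → Neighbours (Cs q) v
    neighbours q = subst (Neighbours (Cs q)) (proj₂ (through q)) (cycle-neighbours (Cs q) (proj₁ (through q)))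
    open Neighbours

    owner : Fin j ⊎ Fin j → Fin j
    owner = [ id , id ]′

    end : Fin j ⊎ Fin j → Fin n
    end (inj₁ q) = left (neighbours q)
    end (inj₂ q) = right (neighbours q)

    end-edge : ∀ p → CycleEdge (Cs (owner p)) v (end p)
    end-edge (inj₁ q) = left-edge (neighbours q)
    end-edge (inj₂ q) = right-edge (neighbours q)

    end-injective : Injective _≡_ _≡_ end
    end-injective {p} {p′} eq with owner p ≟ᶠ owner p′
    ... | no owners≢ = ⊥-elim (disjoint _ _ owners≢ v (end p) (end-edge p)
                                 (subst (CycleEdge (Cs (owner p′)) v) (sym eq) (end-edge p′)))
    end-injective {inj₁ q} {inj₁ _} eq | yes refl = refl
    end-injective {inj₂ q} {inj₂ _} eq | yes refl = refl
    end-injective {inj₁ q} {inj₂ _} eq | yes refl = ⊥-elim (left≢right (neighbours q) eq)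
    end-injective {inj₂ q} {inj₁ _} eq | yes refl = ⊥-elim (left≢right (neighbours q) (sym eq))

module Walks (T : Graph n) where


  Walk : Fin n → Fin n → Set
  Walk = Star (Adj T)

  private variable
    a b c x y u v : Fin n

  length : Walk a b → ℕ
  length ε = 0
  length (_ ◅ w) = suc (length w)

  length-◅◅ : (v : Walk a b) (w : Walk b c) → length (v ◅◅ w) ≡ length v + length w
  length-◅◅ ε w = refl
  length-◅◅ (_ ◅ v) w = cong suc (length-◅◅ v w)

  length-revApp : (v : Walk b a) (w : Walk b c) → length (revApp (Adj-sym T) v w) ≡ length v + length w
  length-revApp ε w = refl
  length-revApp (e ◅ v) w = trans (length-revApp v (Adj-sym T e ◅ w)) (+-suc (length v) (length w))

  length-reverse : (w : Walk a b) → length (reverse (Adj-sym T) w) ≡ length w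
  length-reverse w = trans (length-revApp w ε) (+-identityʳ (length w))

  vertex : (w : Walk a b) → Fin (suc (length w)) → Fin n
  vertex {a} w zero = a
  vertex (_ ◅ w) (suc i) = vertex w i

  vertex-last : (w : Walk a b) → vertex w (fromℕ (length w)) ≡ b
  vertex-last ε = refl
  vertex-last (_ ◅ w) = vertex-last w

  data Step : Walk a b → Fin n → Fin n → Set where
    here  : {e : Adj T a x} {w : Walk x b} → Step (e ◅ w) a x
    there : {e : Adj T a x} {w : Walk x b} → Step w u v → Step (e ◅ w) u v

  Edge : Walk a b → Fin n → Fin n → Set
  Edge w u v = Step w u v ⊎ Step w v u

  Step-adj : {w : Walk a b} → Step w u v → Adj T u v
  Step-adj (here {e = e}) = e
  Step-adj (there s) = Step-adj s

  Step? : (w : Walk a b) (u v : Fin n) → Dec (Step w u v)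
  Step? ε u v = no λ ()
  Step? (_◅_ {a} {x} e w) u v with a ≟ᶠ u | x ≟ᶠ v | Step? w u v
  ... | yes refl | yes refl | _ = yes here
  ... | _ | _ | yes s = yes (there s)
  ... | no a≢u | _ | no ¬s = no λ { here → a≢u refl ; (there s) → ¬s s }
  ... | yes _ | no x≢v | no ¬s = no λ { here → x≢v refl ; (there s) → ¬s s }

  step-vertex : (w : Walk a b) (j : Fin (length w)) → Step w (vertex w (inject₁ j)) (vertex w (suc j))
  step-vertex (_ ◅ w) zero = here
  step-vertex (_ ◅ w) (suc j) = there (step-vertex w j)

  split : {w : Walk a b} → Step w x y →
          Σ (Walk a x) λ w₁ → Σ (Walk y b) λ w₂ → length w ≡ length w₁ + suc (length w₂)
  split (here {w = w}) = ε , w , refl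
  split (there {e = e} s) with split s
  ... | w₁ , w₂ , eq = e ◅ w₁ , w₂ , cong suc eq

  _⊆_ : Walk a b → Walk c x → Set
  w ⊆ w′ = ∀ {u v} → Step w u v → Step w′ u v

  IsPath : Walk a b → Set
  IsPath ε = ⊤
  IsPath (_◅_ {a} _ w) = (∀ i → vertex w i ≢ a) × IsPath w

  path-vertex-injective : (w : Walk a b) → IsPath w → Injective _≡_ _≡_ (vertex w)
  path-vertex-injective ε _ {zero} {zero} _ = refl
  path-vertex-injective (_ ◅ w) _ {zero} {zero} _ = refl
  path-vertex-injective (_ ◅ w) (fresh , _) {zero} {suc j} eq = ⊥-elim (fresh j (sym eq))
  path-vertex-injective (_ ◅ w) (fresh , _) {suc i} {zero} eq = ⊥-elim (fresh i eq)
  path-vertex-injective (_ ◅ w) (_ , p) {suc i} {suc j} eq = cong suc (path-vertex-injective w p eq)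

  suffix : (w : Walk a b) → IsPath w → (i : Fin (suc (length w))) → vertex w i ≡ c →
           Σ (Walk c b) λ w′ → IsPath w′ × w′ ⊆ w
  suffix w p zero refl = w , p , λ s → s
  suffix (_ ◅ w) (_ , p) (suc i) eq with suffix w p i eq
  ... | w′ , p′ , w′⊆w = w′ , p′ , there ∘ w′⊆w

  toPath : (w : Walk a b) → Σ (Walk a b) λ w′ → IsPath w′ × w′ ⊆ w
  toPath ε = ε , tt , λ s → s
  toPath (_◅_ {a} e w) with toPath w
  ... | w′ , p′ , w′⊆w with any? (λ i → vertex w′ i ≟ᶠ a)
  ...   | yes (i , eq) with suffix w′ p′ i eq
  ...     | w″ , p″ , w″⊆w′ = w″ , p″ , there ∘ w′⊆w ∘ w″⊆w′
  toPath (e ◅ w) | w′ , p′ , w′⊆w | no a∉w′ =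
    e ◅ w′ , ((λ i eq → a∉w′ (i , eq)) , p′) , λ { here → here ; (there s) → there (w′⊆w s) }

module Routes (T : Graph n) where

  open Walks T

  record Route : Set where
    constructor route
    field
      {src dst} : Fin n
      walk : Walk src dst
  open Route public

  Ends : Route → Fin n → Set
  Ends r z = z ≡ src r ⊎ z ≡ dst r

  Proper : Route → Set
  Proper r = src r ≢ dst r

  record Apart (r r′ : Route) : Set where
    constructor apart
    field disjoint : ∀ {z} → Ends r z → Ends r′ z → ⊥

  Apart-sym : ∀ {r r′} → Apart r r′ → Apart r′ r
  Apart-sym (apart ap) = apart λ z∈r′ z∈r → ap z∈r z∈r′

  Apart-within : ∀ {r₁ r r′ r″} → (∀ {z} → Ends r₁ z → Ends r z ⊎ Ends r′ z) →
                 Apart r r″ → Apart r′ r″ → Apart r₁ r″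
  Apart-within r₁⊆ (apart ap) (apart ap′) =
    apart λ z∈r₁ z∈r″ → [ flip ap z∈r″ , flip ap′ z∈r″ ]′ (r₁⊆ z∈r₁)

  len : Route → ℕ
  len r = length (walk r)

  Crossing : Route → Route → Set
  Crossing r r′ = ∃₂ λ x y → Step (walk r) x y × Edge (walk r′) x y

  Crossing? : ∀ r r′ → Dec (Crossing r r′)
  Crossing? r r′ = any? λ x → any? λ y → Step? (walk r) x y ×-dec (Step? (walk r′) x y ⊎-dec Step? (walk r′) y x)

  edges⇒crossing : ∀ {r r′ x y} → Edge (walk r) x y → Edge (walk r′) x y → Crossing r r′
  edges⇒crossing (inj₁ s) e′ = _ , _ , s , e′
  edges⇒crossing (inj₂ s) (inj₁ s′) = _ , _ , s , inj₂ s′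
  edges⇒crossing (inj₂ s) (inj₂ s′) = _ , _ , s , inj₁ s′

  record Uncrossing (r r′ : Route) : Set where
    field
      r₁ r₂    : Route
      shorter  : len r₁ + len r₂ < len r + len r′
      proper₁  : Proper r₁
      proper₂  : Proper r₂
      apart₁₂  : Apart r₁ r₂
      within₁  : ∀ {z} → Ends r₁ z → Ends r z ⊎ Ends r′ z
      within₂  : ∀ {z} → Ends r₂ z → Ends r z ⊎ Ends r′ z

  private
    drop-two : ∀ {m n} → suc (suc m) ≡ n → m < n
    drop-two refl = m<n⇒m<1+n (n<1+n _)

    rejoin-same : ∀ p q r s → suc (suc (p + q + (r + s))) ≡ p + suc r + (q + suc s)
    rejoin-same = solve-∀

    rejoin-opposite : ∀ p q r s → suc (suc (p + s + (q + r))) ≡ p + suc r + (q + suc s)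
    rejoin-opposite = solve-∀

  -- Cut both walks at the shared edge and reconnect the four halves without it: the ends are
  -- re-paired and the total length drops by two. Which halves are joined depends on whether r′
  -- traverses the edge in the same direction as r.
  uncross : ∀ r r′ → Proper r → Proper r′ → Apart r r′ → Crossing r r′ → Uncrossing r r′
  uncross (route {a} {b} w) (route {c} {d} w′) a≢b c≢d (apart ap) (_ , _ , s , inj₁ s′)
    with split s | split s′
  ... | w₁ , w₂ , eq | w₁′ , w₂′ , eq′ = record
    { r₁ = route (w₁ ◅◅ reverse (Adj-sym T) w₁′)
    ; r₂ = route (reverse (Adj-sym T) w₂ ◅◅ w₂′)
    ; shorter = begin-strict
        length (w₁ ◅◅ reverse _ w₁′) + length (reverse _ w₂ ◅◅ w₂′)
          ≡⟨ cong₂ _+_ (trans (length-◅◅ w₁ _) (cong (length w₁ +_) (length-reverse w₁′)))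
                       (trans (length-◅◅ _ w₂′) (cong (_+ length w₂′) (length-reverse w₂))) ⟩
        length w₁ + length w₁′ + (length w₂ + length w₂′)
          <⟨ drop-two (rejoin-same (length w₁) (length w₁′) (length w₂) (length w₂′)) ⟩
        length w₁ + suc (length w₂) + (length w₁′ + suc (length w₂′))
          ≡⟨ sym (cong₂ _+_ eq eq′) ⟩
        length w + length w′ ∎
    ; proper₁ = λ a≡c → ap (inj₁ refl) (inj₁ a≡c)
    ; proper₂ = λ b≡d → ap (inj₂ refl) (inj₂ b≡d)
    ; apart₁₂ = apart λ { (inj₁ refl) (inj₁ a≡b) → a≢b a≡b
                        ; (inj₁ refl) (inj₂ a≡d) → ap (inj₁ refl) (inj₂ a≡d)
                        ; (inj₂ refl) (inj₁ c≡b) → ap (inj₂ refl) (inj₁ (sym c≡b))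
                        ; (inj₂ refl) (inj₂ c≡d) → c≢d c≡d }
    ; within₁ = λ { (inj₁ z≡a) → inj₁ (inj₁ z≡a) ; (inj₂ z≡c) → inj₂ (inj₁ z≡c) }
    ; within₂ = λ { (inj₁ z≡b) → inj₁ (inj₂ z≡b) ; (inj₂ z≡d) → inj₂ (inj₂ z≡d) }
    }
    where open ≤-Reasoning
  uncross (route {a} {b} w) (route {c} {d} w′) a≢b c≢d (apart ap) (_ , _ , s , inj₂ s′)
    with split s | split s′
  ... | w₁ , w₂ , eq | w₁′ , w₂′ , eq′ = record
    { r₁ = route (w₁ ◅◅ w₂′)
    ; r₂ = route (w₁′ ◅◅ w₂)
    ; shorter = begin-strict
        length (w₁ ◅◅ w₂′) + length (w₁′ ◅◅ w₂)
          ≡⟨ cong₂ _+_ (length-◅◅ w₁ w₂′) (length-◅◅ w₁′ w₂) ⟩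
        length w₁ + length w₂′ + (length w₁′ + length w₂)
          <⟨ drop-two (rejoin-opposite (length w₁) (length w₁′) (length w₂) (length w₂′)) ⟩
        length w₁ + suc (length w₂) + (length w₁′ + suc (length w₂′))
          ≡⟨ sym (cong₂ _+_ eq eq′) ⟩
        length w + length w′ ∎
    ; proper₁ = λ a≡d → ap (inj₁ refl) (inj₂ a≡d)
    ; proper₂ = λ c≡b → ap (inj₂ refl) (inj₁ (sym c≡b))
    ; apart₁₂ = apart λ { (inj₁ refl) (inj₁ a≡c) → ap (inj₁ refl) (inj₁ a≡c)
                        ; (inj₁ refl) (inj₂ a≡b) → a≢b a≡b
                        ; (inj₂ refl) (inj₁ d≡c) → c≢d (sym d≡c)
                        ; (inj₂ refl) (inj₂ d≡b) → ap (inj₂ refl) (inj₂ (sym d≡b)) }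
    ; within₁ = λ { (inj₁ z≡a) → inj₁ (inj₁ z≡a) ; (inj₂ z≡d) → inj₂ (inj₂ z≡d) }
    ; within₂ = λ { (inj₁ z≡c) → inj₂ (inj₁ z≡c) ; (inj₂ z≡b) → inj₁ (inj₂ z≡b) }
    }
    where open ≤-Reasoning

module Pairings (T : Graph n) (S : Subset n) where

  open Routes T

  record Pairing (rs : Vector Route m) : Set where
    field
      proper : ∀ q → Proper (rs q)
      ends∈S : ∀ q {z} → Ends (rs q) z → z ∈ S
      separated : ∀ {q q′} → q ≢ q′ → Apart (rs q) (rs q′)
  open Pairing

  NonCrossing : Vector Route m → Set
  NonCrossing rs = ∀ {q q′} → q ≢ q′ → ¬ Crossing (rs q) (rs q′)

  total : Vector Route m → ℕ
  total rs = sum (len ∘ rs)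

  module _ {rs : Vector Route m} {i j : Fin m} (i≢j : i ≢ j) (U : Uncrossing (rs i) (rs j)) where

    open Uncrossing U

    uncrossed : Vector Route m
    uncrossed = replace (replace rs i r₁) j r₂

    uncrossed-shorter : total uncrossed < total rs
    uncrossed-shorter = +-cancelʳ-< (len (rs i) + len (rs j)) (total uncrossed) (total rs) (begin-strict
      total uncrossed + (len (rs i) + len (rs j)) ≡⟨ x+[y+z]≡x+z+y (total uncrossed) _ _ ⟩
      total uncrossed + len (rs j) + len (rs i)   ≡⟨ cong (_+ len (rs i)) total-after-j ⟩
      total after-i + len r₂ + len (rs i)         ≡⟨ x+y+z≡x+z+y (total after-i) _ _ ⟩
      total after-i + len (rs i) + len r₂         ≡⟨ cong (_+ len r₂) total-after-i ⟩
      total rs + len r₁ + len r₂                  ≡⟨ +-assoc (total rs) _ _ ⟩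
      total rs + (len r₁ + len r₂)                <⟨ +-monoʳ-< (total rs) shorter ⟩
      total rs + (len (rs i) + len (rs j))        ∎)
      where
      open ≤-Reasoning

      after-i : Vector Route m
      after-i = replace rs i r₁

      total-after-i : total after-i + len (rs i) ≡ total rs + len r₁
      total-after-i = subst (λ r → total after-i + len (rs i) ≡ total rs + len r) (replace-≡ rs i r₁)
        (sum-update (len ∘ after-i) (len ∘ rs) i λ q q≢i → cong len (replace-≢ rs r₁ q≢i))

      total-after-j : total uncrossed + len (rs j) ≡ total after-i + len r₂
      total-after-j = subst₂ (λ r r′ → total uncrossed + len r ≡ total after-i + len r′)
        (replace-≢ rs r₁ (i≢j ∘ sym)) (replace-≡ after-i j r₂)
        (sum-update (len ∘ uncrossed) (len ∘ after-i) j λ q q≢j → cong len (replace-≢ after-i r₂ q≢j))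

      x+[y+z]≡x+z+y : ∀ x y z → x + (y + z) ≡ x + z + y
      x+[y+z]≡x+z+y = solve-∀

      x+y+z≡x+z+y : ∀ x y z → x + y + z ≡ x + z + y
      x+y+z≡x+z+y = solve-∀

    uncrossed-elim : (Q : Fin m → Route → Set) → Q j r₂ → Q i r₁ → (∀ q → q ≢ i → q ≢ j → Q q (rs q)) →
                     ∀ q → Q q (uncrossed q)
    uncrossed-elim Q Qj Qi Qrs q with q ≟ᶠ j
    ... | yes refl = Qj
    ... | no q≢j with q ≟ᶠ i
    ...   | yes refl = Qi
    ...   | no q≢i = Qrs q q≢i q≢j

    uncrossed-pairing : Pairing rs → Pairing uncrossed
    uncrossed-pairing P = record
      { proper = uncrossed-elim (λ _ → Proper) proper₂ proper₁ (λ q _ _ → proper P q)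
      ; ends∈S = uncrossed-elim (λ _ r → ∀ {z} → Ends r z → z ∈ S)
                   (in-S ∘ within₂) (in-S ∘ within₁) (λ q _ _ → ends∈S P q)
      ; separated = λ {q} → separated′ q
      }
      where
      in-S : ∀ {z} → Ends (rs i) z ⊎ Ends (rs j) z → z ∈ S
      in-S = [ ends∈S P i , ends∈S P j ]′

      new-apart-old : ∀ {q} → q ≢ i → q ≢ j → Apart r₁ (rs q) × Apart r₂ (rs q)
      new-apart-old q≢i q≢j =
        Apart-within within₁ (separated P (q≢i ∘ sym)) (separated P (q≢j ∘ sym)) ,
        Apart-within within₂ (separated P (q≢i ∘ sym)) (separated P (q≢j ∘ sym))

      separated′ : ∀ q {q′} → q ≢ q′ → Apart (uncrossed q) (uncrossed q′)
      separated′ = uncrossed-elim (λ q r → ∀ {q′} → q ≢ q′ → Apart r (uncrossed q′))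
        (λ {q′} → uncrossed-elim (λ q′ r′ → j ≢ q′ → Apart r₂ r′)
          (λ j≢j → ⊥-elim (j≢j refl)) (λ _ → Apart-sym apart₁₂)
          (λ _ q′≢i q′≢j _ → proj₂ (new-apart-old q′≢i q′≢j)) q′)
        (λ {q′} → uncrossed-elim (λ q′ r′ → i ≢ q′ → Apart r₁ r′)
          (λ _ → apart₁₂) (λ i≢i → ⊥-elim (i≢i refl))
          (λ _ q′≢i q′≢j _ → proj₁ (new-apart-old q′≢i q′≢j)) q′)
        (λ q q≢i q≢j {q′} → uncrossed-elim (λ q′ r′ → q ≢ q′ → Apart (rs q) r′)
          (λ _ → Apart-sym (proj₂ (new-apart-old q≢i q≢j))) (λ _ → Apart-sym (proj₁ (new-apart-old q≢i q≢j)))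
          (λ _ _ _ → separated P) q′)

  untangle : (rs : Vector Route m) → Pairing rs → Σ (Vector Route m) λ rs′ → Pairing rs′ × NonCrossing rs′
  untangle rs = descend rs (<-wellFounded (total rs))
    where
    descend : (rs : Vector Route m) → Acc _<_ (total rs) → Pairing rs →
              Σ (Vector Route m) λ rs′ → Pairing rs′ × NonCrossing rs′
    descend rs (acc smaller) P with any? (λ i → any? (λ j → ¬? (i ≟ᶠ j) ×-dec Crossing? (rs i) (rs j)))
    ... | no ∄crossing = rs , P , λ q≢q′ c → ∄crossing (_ , _ , q≢q′ , c)
    ... | yes (i , j , i≢j , c) =
      descend (uncrossed i≢j U) (smaller (uncrossed-shorter i≢j U)) (uncrossed-pairing i≢j U P)
      where
      U : Uncrossing (rs i) (rs j)
      U = uncross (rs i) (rs j) (proper P i) (proper P j) (separated P i≢j) c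

  initial-pairing : Connected T → (f : Fin m ⊎ Fin m → Fin n) → Injective _≡_ _≡_ f → (∀ p → f p ∈ S) →
                    Σ (Vector Route m) Pairing
  initial-pairing {m} conn f f-inj f∈S = rs , record
    { proper = λ q eq → case f-inj eq of λ ()
    ; ends∈S = λ q → λ { (inj₁ refl) → f∈S (inj₁ q) ; (inj₂ refl) → f∈S (inj₂ q) }
    ; separated = λ q≢q′ → apart λ z∈q z∈q′ → q≢q′ (same-route z∈q z∈q′)
    }
    where
    rs : Vector Route m
    rs q = route (conn (f (inj₁ q)) (f (inj₂ q)))

    same-route : ∀ {q q′ z} → Ends (rs q) z → Ends (rs q′) z → q ≡ q′
    same-route (inj₁ refl) (inj₁ eq) with f-inj eq
    ... | refl = refl
    same-route (inj₁ refl) (inj₂ eq) with f-inj eq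
    ... | ()
    same-route (inj₂ refl) (inj₁ eq) with f-inj eq
    ... | ()
    same-route (inj₂ refl) (inj₂ eq) with f-inj eq
    ... | refl = refl

module Cones (T : Graph n) (S : Subset n) where

  open Walks T
  open Routes T
  open Pairings T S

  private variable
    u v : Fin (suc n)

  data ConeEdge {a b : Fin n} (w : Walk a b) : Fin (suc n) → Fin (suc n) → Set where
    spokeᵢ : ∀ {z} → z ≡ a ⊎ z ≡ b → ConeEdge w zero (suc z)
    spokeₒ : ∀ {z} → z ≡ a ⊎ z ≡ b → ConeEdge w (suc z) zero
    rim    : ∀ {x y} → Edge w x y → ConeEdge w (suc x) (suc y)

  ConeEdge-⊆ : ∀ {a b} {w w′ : Walk a b} → w ⊆ w′ → ConeEdge w u v → ConeEdge w′ u v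
  ConeEdge-⊆ w⊆w′ (spokeᵢ z∈ab) = spokeᵢ z∈ab
  ConeEdge-⊆ w⊆w′ (spokeₒ z∈ab) = spokeₒ z∈ab
  ConeEdge-⊆ w⊆w′ (rim (inj₁ s)) = rim (inj₁ (w⊆w′ s))
  ConeEdge-⊆ w⊆w′ (rim (inj₂ s)) = rim (inj₂ (w⊆w′ s))

  cone : ∀ {a b} (w : Walk a b) → IsPath w → a ≢ b → a ∈ S → b ∈ S → Cycle (addApex T S)
  cone ε _ a≢a = ⊥-elim (a≢a refl)
  cone {a} (e ◅ w) path _ a∈S b∈S = record
    { k = length w ; verts = vs ; inj = vs-injective _ _ ; step = vs-step ; close = vs-close }
    where
    vs : Fin (3 + length w) → Fin (suc n)
    vs zero = zero
    vs (suc i) = suc (vertex (e ◅ w) i)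

    vs-injective : ∀ i j → vs i ≡ vs j → i ≡ j
    vs-injective zero zero _ = refl
    vs-injective (suc i) (suc j) eq = cong suc (path-vertex-injective (e ◅ w) path (suc-injective eq))

    vs-step : (i : Fin (2 + length w)) → Adj (addApex T S) (vs (inject₁ i)) (vs (suc i))
    vs-step zero = a∈S
    vs-step (suc i) = Step-adj (step-vertex (e ◅ w) i)

    vs-close : Adj (addApex T S) (vs (fromℕ (2 + length w))) zero
    vs-close = subst (_∈ S) (sym (vertex-last (e ◅ w))) b∈S

  cone-edge : ∀ {a b} (w : Walk a b) (path : IsPath w) (a≢b : a ≢ b) (a∈S : a ∈ S) (b∈S : b ∈ S) →
              CycleEdge (cone w path a≢b a∈S b∈S) u v → ConeEdge w u v
  cone-edge ε _ a≢a = ⊥-elim (a≢a refl)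
  cone-edge (e ◅ w) _ _ _ _ (inj₁ (zero , inj₁ (refl , refl))) = spokeᵢ (inj₁ refl)
  cone-edge (e ◅ w) _ _ _ _ (inj₁ (zero , inj₂ (refl , refl))) = spokeₒ (inj₁ refl)
  cone-edge (e ◅ w) _ _ _ _ (inj₁ (suc i , inj₁ (refl , refl))) = rim (inj₁ (step-vertex (e ◅ w) i))
  cone-edge (e ◅ w) _ _ _ _ (inj₁ (suc i , inj₂ (refl , refl))) = rim (inj₂ (step-vertex (e ◅ w) i))
  cone-edge (e ◅ w) _ _ _ _ (inj₂ (inj₁ (refl , refl))) = spokeₒ (inj₂ (vertex-last (e ◅ w)))
  cone-edge (e ◅ w) _ _ _ _ (inj₂ (inj₂ (refl , refl))) = spokeᵢ (inj₂ (vertex-last (e ◅ w)))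

  cones-disjoint : ∀ {r r′} → Apart r r′ → ¬ Crossing r r′ → ConeEdge (walk r) u v → ¬ ConeEdge (walk r′) u v
  cones-disjoint (apart ap) _ (spokeᵢ z∈r) (spokeᵢ z∈r′) = ap z∈r z∈r′
  cones-disjoint (apart ap) _ (spokeₒ z∈r) (spokeₒ z∈r′) = ap z∈r z∈r′
  cones-disjoint _ ¬crossing (rim e) (rim e′) = ¬crossing (edges⇒crossing e e′)

  module _ (r : Route) (r-proper : Proper r) (r⊆S : ∀ {z} → Ends r z → z ∈ S) where

    private
      shortcut : Σ (Walk (src r) (dst r)) λ w → IsPath w × w ⊆ walk r
      shortcut = toPath (walk r)

    routeCycle : Cycle (addApex T S)
    routeCycle = cone (proj₁ shortcut) (proj₁ (proj₂ shortcut)) r-proper (r⊆S (inj₁ refl)) (r⊆S (inj₂ refl))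

    routeCycle-edge : CycleEdge routeCycle u v → ConeEdge (walk r) u v
    routeCycle-edge = ConeEdge-⊆ (proj₂ (proj₂ shortcut)) ∘ cone-edge _ _ _ _ _

  untangled⇒cycles : (rs : Vector Route m) → Pairing rs → NonCrossing rs → HasEdgeDisjointCycles (addApex T S) m
  untangled⇒cycles {m} rs P noncrossing = cycles , λ q q′ q≢q′ u v e e′ →
    cones-disjoint (separated q≢q′) (noncrossing q≢q′)
      (routeCycle-edge _ (proper q) (ends∈S q) e) (routeCycle-edge _ (proper q′) (ends∈S q′) e′)
    where
    open Pairing P
    cycles : Fin m → Cycle (addApex T S)
    cycles q = routeCycle (rs q) (proper q) (ends∈S q)

  lower-bound : Connected T → HasEdgeDisjointCycles (addApex T S) (∣ S ∣ / 2)
  lower-bound conn with pairs-injection S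
  ... | f , f-inj , f∈S with initial-pairing conn f f-inj f∈S
  ... | rs₀ , P₀ with untangle rs₀ P₀
  ... | rs , P , noncrossing = untangled⇒cycles rs P noncrossing

module Apex (T : Graph n) (S : Subset n) where

  private
    adj-punchOut : ∀ {x y} (x≢0 : zero ≢ x) (y≢0 : zero ≢ y) →
                   Adj (addApex T S) x y → Adj T (punchOut x≢0) (punchOut y≢0)
    adj-punchOut {zero} x≢0 _ = ⊥-elim (x≢0 refl)
    adj-punchOut {suc _} {zero} _ y≢0 = ⊥-elim (y≢0 refl)
    adj-punchOut {suc _} {suc _} _ _ x~y = x~y

  apex-free-cycle : (C : Cycle (addApex T S)) → (∀ p → zero ≢ verts C p) → Cycle T
  apex-free-cycle C avoids = record
    { k = k C
    ; verts = λ p → punchOut (avoids p)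
    ; inj = inj C ∘ punchOut-injective (avoids _) (avoids _)
    ; step = λ i → adj-punchOut (avoids _) (avoids _) (step C i)
    ; close = adj-punchOut (avoids _) (avoids _) (close C)
    }

  cycle-meets-apex : ¬ Cycle T → (C : Cycle (addApex T S)) → ∃ λ p → verts C p ≡ zero
  cycle-meets-apex acyclic C with any? (λ p → verts C p ≟ᶠ zero)
  ... | yes meets = meets
  ... | no avoids = ⊥-elim (acyclic (apex-free-cycle C λ p 0≡v → avoids (p , sym 0≡v)))

  apex-neighbour : ∀ x → Adj (addApex T S) zero x → Σ (Fin n) λ z → suc z ≡ x × z ∈ S
  apex-neighbour (suc z) z∈S = z , refl , z∈S

  upper-bound : ∀ {j} → ¬ Cycle T → HasEdgeDisjointCycles (addApex T S) j → j + j ≤ ∣ S ∣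
  upper-bound acyclic (Cs , disjoint)
    with cycles-through⇒neighbours Cs disjoint zero (cycle-meets-apex acyclic ∘ Cs)
  ... | f , f-inj , apex~f = pairs-injection⇒≤∣∣ S g g-injective (proj₂ ∘ proj₂ ∘ lowered)
    where
    lowered : ∀ p → Σ (Fin n) λ z → suc z ≡ f p × z ∈ S
    lowered p = apex-neighbour (f p) (apex~f p)
    g : Fin _ ⊎ Fin _ → Fin n
    g = proj₁ ∘ lowered
    g-injective : Injective _≡_ _≡_ g
    g-injective {p} {p′} eq =
      f-inj (trans (sym (proj₁ (proj₂ (lowered p)))) (trans (cong suc eq) (proj₁ (proj₂ (lowered p′)))))

open Apex using (upper-bound)
open Cones using (lower-bound)

lemma2p2 : ∀ (n : ℕ) (T : Graph n) → IsTree T →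
    ∀ (t : ℕ) (S : Subset n) → ∣ S ∣ ≡ t → 1 ≤ t → t ≤ n →
    φ-is (addApex T S) (t / 2)
lemma2p2 n T (connected , acyclic) t S refl _ _ =
  lower-bound T S connected , λ j cycles → m+m≤n⇒m≤n/2 j ∣ S ∣ (upper-bound T S acyclic cycles)
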